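{- Let $G$ and $H$ be connected graphs. Then $\gamma_P(G \Box H) \le \min\{\gamma(G)Z(H),\ \gamma(H)Z(G)\}$.
   Context: Graphs are finite and simple. $\gamma(G)$ is the domination number (minimum size of $D\subseteq V(G)$ with $N[D]=V(G)$). A set $Z \subseteq V(G)$ is a zero forcing set if, starting with the vertices of $Z$ observed and repeatedly letting any observed vertex with exactly one unobserved neighbor make that neighbor observed, eventually all vertices are observed; $Z(G)$ is the minimum size of a zero forcing set. A power dominating set is a set $S$ such that, after first observing $S$ and all neighbors of vertices of $S$, and then applying the same propagation rule repeatedly, all vertices are observed; $\gamma_P(G)$ is the minimum size of a power dominating set. The Cartesian product $G \Box H$ has vertex set $V(G)\times V(H)$, with $(g_1,h_1)$ adjacent to $(g_2,h_2)$ iff either $g_1=g_2$ and $h_1h_2 \in E(H)$, or $h_1=h_2$ and $g_1g_2\in E(G)$. -}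

module Defs where

open import Data.Nat using (ℕ; _*_; _≤_)
open import Data.Fin using (Fin; remQuot)
open import Data.Fin.Subset using (Subset; _∈_; ∣_∣)
open import Data.Product using (Σ; _×_; _,_; proj₁; proj₂)
open import Data.Sum using (_⊎_)
open import Relation.Binary.PropositionalEquality using (_≡_; _≢_)
open import Relation.Nullary using (¬_)

record Graph : Set₁ where
  field
    n     : ℕ
    Adj   : Fin n → Fin n → Set
    sym   : ∀ {u v} → Adj u v → Adj v u
    irrefl : ∀ {u} → ¬ Adj u u
open Graph public

data Reach (G : Graph) : Fin (n G) → Fin (n G) → Set where
  here : ∀ {u} → Reach G u u
  step : ∀ {u v w} → Adj G u v → Reach G v w → Reach G u w

Connected : Graph → Set
Connected G = ∀ u v → Reach G u v

Dominating : (G : Graph) → Subset (n G) → Set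
Dominating G D = ∀ v → v ∈ D ⊎ Σ (Fin (n G)) (λ u → u ∈ D × Adj G u v)

data Observed (G : Graph) (Init : Fin (n G) → Set) : Fin (n G) → Set where
  init  : ∀ {v} → Init v → Observed G Init v
  force : ∀ {u w} → Observed G Init u → Adj G u w
        → (∀ x → Adj G u x → x ≢ w → Observed G Init x)
        → Observed G Init w

ZeroForcing : (G : Graph) → Subset (n G) → Set
ZeroForcing G Z = ∀ v → Observed G (λ x → x ∈ Z) v

ClosedNbhd : (G : Graph) → Subset (n G) → Fin (n G) → Set
ClosedNbhd G S v = v ∈ S ⊎ Σ (Fin (n G)) (λ u → u ∈ S × Adj G u v)

PowerDominating : (G : Graph) → Subset (n G) → Set
PowerDominating G S = ∀ v → Observed G (ClosedNbhd G S) v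

IsMinimum : ∀ {m} → (Subset m → Set) → ℕ → Set
IsMinimum {m} P k = Σ (Subset m) (λ S → P S × ∣ S ∣ ≡ k) × (∀ S → P S → k ≤ ∣ S ∣)

IsDominationNumber : Graph → ℕ → Set
IsDominationNumber G = IsMinimum (Dominating G)

IsZeroForcingNumber : Graph → ℕ → Set
IsZeroForcingNumber G = IsMinimum (ZeroForcing G)

IsPowerDominationNumber : Graph → ℕ → Set
IsPowerDominationNumber G = IsMinimum (PowerDominating G)

-- Cartesian product; vertex (g , h) is encoded as combine g h : Fin (n G * n H).
_□_ : Graph → Graph → Graph
G □ H = record
  { n = n G * n H
  ; Adj = λ a b → ProdAdj (remQuot (n H) a) (remQuot (n H) b)
  ; sym = λ { {a} {b} p → psym (remQuot (n H) a) (remQuot (n H) b) p }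
  ; irrefl = λ { {a} p → pirr (remQuot (n H) a) p }
  }
  where
  ProdAdj : Fin (n G) × Fin (n H) → Fin (n G) × Fin (n H) → Set
  ProdAdj (g₁ , h₁) (g₂ , h₂) = (g₁ ≡ g₂ × Adj H h₁ h₂) ⊎ (h₁ ≡ h₂ × Adj G g₁ g₂)
  psym : ∀ x y → ProdAdj x y → ProdAdj y x
  psym _ _ (Data.Sum.inj₁ (Relation.Binary.PropositionalEquality.refl , a)) =
    Data.Sum.inj₁ (Relation.Binary.PropositionalEquality.refl , sym H a)
  psym _ _ (Data.Sum.inj₂ (Relation.Binary.PropositionalEquality.refl , a)) =
    Data.Sum.inj₂ (Relation.Binary.PropositionalEquality.refl , sym G a)
  pirr : ∀ x → ¬ ProdAdj x x
  pirr _ (Data.Sum.inj₁ (_ , a)) = irrefl H a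
  pirr _ (Data.Sum.inj₂ (_ , a)) = irrefl G a

-- If D dominates G and Z is a zero forcing set of H, then D × Z power dominates G □ H.
-- The domination step observes every vertex (g , z) with z ∈ Z, and then every
-- H-fibre {g} × H replays the forcing process of Z: when u forces w in H, the vertex
-- (g , u) forces (g , w), because its other H-neighbours (g , x) are observed along
-- with x and its G-neighbours (g' , u) are observed along with u.  Exchanging the
-- roles of G and H gives the other bound.
module Submission where

open import Defs hiding (sym)
open import Data.Nat using (ℕ; _*_; _≤_; _⊓_; _+_; suc)
open import Data.Nat.Properties using (⊓-glb; *-comm)
open import Data.Fin using (Fin; combine; remQuot; _↑ˡ_; _↑ʳ_)
open import Data.Fin.Properties using (remQuot-combine; combine-remQuot)
open import Data.Fin.Subset using (Subset; _∈_; ∣_∣; inside; outside; ⊥)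
open import Data.Fin.Subset.Properties using (∣⊥∣≡0)
open import Data.Vec using ([]; _∷_; _++_; here; there)
open import Data.Product using (_×_; _,_; ∃₂)
open import Data.Sum using (_⊎_; inj₁; inj₂)
import Data.Sum as Sum
open import Relation.Binary.PropositionalEquality
  using (_≡_; _≢_; refl; sym; cong; cong₂; subst; subst₂; trans)

∈-++⁺ˡ : ∀ {m n} {i : Fin m} {p : Subset m} (q : Subset n) → i ∈ p → i ↑ˡ n ∈ p ++ q
∈-++⁺ˡ q here        = here
∈-++⁺ˡ q (there i∈p) = there (∈-++⁺ˡ q i∈p)

∈-++⁺ʳ : ∀ {m n} {j : Fin n} (p : Subset m) {q : Subset n} → j ∈ q → m ↑ʳ j ∈ p ++ q
∈-++⁺ʳ []      j∈q = j∈q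
∈-++⁺ʳ (_ ∷ p) j∈q = there (∈-++⁺ʳ p j∈q)

∣p++q∣≡∣p∣+∣q∣ : ∀ {m n} (p : Subset m) (q : Subset n) → ∣ p ++ q ∣ ≡ ∣ p ∣ + ∣ q ∣
∣p++q∣≡∣p∣+∣q∣ []            q = refl
∣p++q∣≡∣p∣+∣q∣ (inside  ∷ p) q = cong suc (∣p++q∣≡∣p∣+∣q∣ p q)
∣p++q∣≡∣p∣+∣q∣ (outside ∷ p) q = ∣p++q∣≡∣p∣+∣q∣ p q

-- The product subset {combine i j ∣ i ∈ p , j ∈ q}, laid out block by block as combine is.
infixr 7 _⊗_
_⊗_ : ∀ {m n} → Subset m → Subset n → Subset (m * n)
[]            ⊗ q = []
(inside  ∷ p) ⊗ q = q ++ p ⊗ q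
(outside ∷ p) ⊗ q = ⊥ ++ p ⊗ q

combine-∈-⊗ : ∀ {m n} {i : Fin m} {j : Fin n} {p : Subset m} {q : Subset n}
            → i ∈ p → j ∈ q → combine i j ∈ p ⊗ q
combine-∈-⊗ here j∈q = ∈-++⁺ˡ _ j∈q
combine-∈-⊗ {p = inside  ∷ _} {q} (there i∈p) j∈q = ∈-++⁺ʳ q (combine-∈-⊗ i∈p j∈q)
combine-∈-⊗ {p = outside ∷ _}     (there i∈p) j∈q = ∈-++⁺ʳ ⊥ (combine-∈-⊗ i∈p j∈q)

∣p⊗q∣≡∣p∣*∣q∣ : ∀ {m n} (p : Subset m) (q : Subset n) → ∣ p ⊗ q ∣ ≡ ∣ p ∣ * ∣ q ∣
∣p⊗q∣≡∣p∣*∣q∣ []            q = refl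
∣p⊗q∣≡∣p∣*∣q∣ (inside  ∷ p) q =
  trans (∣p++q∣≡∣p∣+∣q∣ q (p ⊗ q)) (cong (∣ q ∣ +_) (∣p⊗q∣≡∣p∣*∣q∣ p q))
∣p⊗q∣≡∣p∣*∣q∣ {n = n} (outside ∷ p) q =
  trans (∣p++q∣≡∣p∣+∣q∣ (⊥ {n}) (p ⊗ q)) (cong₂ _+_ (∣⊥∣≡0 n) (∣p⊗q∣≡∣p∣*∣q∣ p q))

record CartesianCoordinates (P A B : Graph) : Set where
  field
    pair   : Fin (n A) → Fin (n B) → Fin (n P)
    covers : ∀ x → ∃₂ λ a b → pair a b ≡ x
    adj⁺   : ∀ {a a' b b'} → (a ≡ a' × Adj B b b') ⊎ (b ≡ b' × Adj A a a')
           → Adj P (pair a b) (pair a' b')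
    adj⁻   : ∀ {a a' b b'} → Adj P (pair a b) (pair a' b')
           → (a ≡ a' × Adj B b b') ⊎ (b ≡ b' × Adj A a a')

swap-coordinates : ∀ {P A B} → CartesianCoordinates P A B → CartesianCoordinates P B A
swap-coordinates C = record
  { pair   = λ b a → pair a b
  ; covers = λ x → let (a , b , eq) = covers x in b , a , eq
  ; adj⁺   = λ adj → adj⁺ (Sum.swap adj)
  ; adj⁻   = λ adj → Sum.swap (adj⁻ adj)
  }
  where open CartesianCoordinates C

□-coordinates : ∀ G H → CartesianCoordinates (G □ H) G H
□-coordinates G H = record
  { pair   = combine
  ; covers = λ x → let (g , h) = remQuot {n G} (n H) x in g , h , combine-remQuot {n G} (n H) x
  ; adj⁺   = adj⁺
  ; adj⁻   = adj⁻
  }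
  where
  ProductAdj : Fin (n G) × Fin (n H) → Fin (n G) × Fin (n H) → Set
  ProductAdj (g , h) (g' , h') = (g ≡ g' × Adj H h h') ⊎ (h ≡ h' × Adj G g g')
  adj⁺ : ∀ {g g' h h'} → ProductAdj (g , h) (g' , h') → Adj (G □ H) (combine g h) (combine g' h')
  adj⁺ {g} {g'} {h} {h'} =
    subst₂ ProductAdj (sym (remQuot-combine {n G} g h)) (sym (remQuot-combine {n G} g' h'))
  adj⁻ : ∀ {g g' h h'} → Adj (G □ H) (combine g h) (combine g' h') → ProductAdj (g , h) (g' , h')
  adj⁻ {g} {g'} {h} {h'} = subst₂ ProductAdj (remQuot-combine {n G} g h) (remQuot-combine {n G} g' h')

module _ {P A B : Graph} (C : CartesianCoordinates P A B) where
  open CartesianCoordinates C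

  data Coordinates : Fin (n P) → Set where
    ⟨_,_⟩ : ∀ a b → Coordinates (pair a b)

  coordinates : ∀ x → Coordinates x
  coordinates x with covers x
  ... | a , b , refl = ⟨ a , b ⟩

  dominating×zeroForcing⇒powerDominating :
    ∀ {D Z S} → Dominating A D → ZeroForcing B Z
    → (∀ {a b} → a ∈ D → b ∈ Z → pair a b ∈ S) → PowerDominating P S
  dominating×zeroForcing⇒powerDominating {D} {Z} {S} dom zf D×Z⊆S x
    with coordinates x
  ... | ⟨ a , b ⟩ = fibre (zf b) a
    where
    fibre : ∀ {b} → Observed B (_∈ Z) b → ∀ a → Observed P (ClosedNbhd P S) (pair a b)
    fibre (init b∈Z) a with dom a
    ... | inj₁ a∈D             = init (inj₁ (D×Z⊆S a∈D b∈Z))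
    ... | inj₂ (d , d∈D , d~a) = init (inj₂ (_ , D×Z⊆S d∈D b∈Z , adj⁺ (inj₂ (refl , d~a))))
    fibre {w} (force {u} u-obs u~w others) a =
      force (fibre u-obs a) (adj⁺ (inj₁ (refl , u~w))) forced
      where
      forced : ∀ y → Adj P (pair a u) y → y ≢ pair a w → Observed P (ClosedNbhd P S) y
      forced y adj y≢aw with coordinates y
      ... | ⟨ a' , b' ⟩ with adj⁻ adj
      ...   | inj₁ (refl , u~b') = fibre (others b' u~b' (λ b'≡w → y≢aw (cong (pair a) b'≡w))) a
      ...   | inj₂ (refl , _)    = fibre u-obs a'

γP[G□H]≤γ[G]*Z[H] : ∀ {G H d z p} → IsDominationNumber G d → IsZeroForcingNumber H z
                  → IsPowerDominationNumber (G □ H) p → p ≤ d * z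
γP[G□H]≤γ[G]*Z[H] {G} {H} {p = p} ((D , dom , ∣D∣≡d) , _) ((Z , zf , ∣Z∣≡z) , _) (_ , minimal) =
  subst (p ≤_) (trans (∣p⊗q∣≡∣p∣*∣q∣ D Z) (cong₂ _*_ ∣D∣≡d ∣Z∣≡z))
    (minimal (D ⊗ Z)
      (dominating×zeroForcing⇒powerDominating (□-coordinates G H) dom zf combine-∈-⊗))

γP[G□H]≤Z[G]*γ[H] : ∀ {G H d z p} → IsZeroForcingNumber G z → IsDominationNumber H d
                  → IsPowerDominationNumber (G □ H) p → p ≤ z * d
γP[G□H]≤Z[G]*γ[H] {G} {H} {p = p} ((Z , zf , ∣Z∣≡z) , _) ((D , dom , ∣D∣≡d) , _) (_ , minimal) =
  subst (p ≤_) (trans (∣p⊗q∣≡∣p∣*∣q∣ Z D) (cong₂ _*_ ∣Z∣≡z ∣D∣≡d))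
    (minimal (Z ⊗ D)
      (dominating×zeroForcing⇒powerDominating (swap-coordinates (□-coordinates G H)) dom zf
        (λ d∈D z∈Z → combine-∈-⊗ z∈Z d∈D)))

lemma3p8 : (G H : Graph) → Connected G → Connected H
         → (dG dH zG zH p : ℕ)
         → IsDominationNumber G dG → IsDominationNumber H dH
         → IsZeroForcingNumber G zG → IsZeroForcingNumber H zH
         → IsPowerDominationNumber (G □ H) p
         → p ≤ (dG * zH) ⊓ (dH * zG)
lemma3p8 G H _ _ dG dH zG zH p γG γH ZG ZH γP =
  ⊓-glb (γP[G□H]≤γ[G]*Z[H] γG ZH γP)
        (subst (p ≤_) (*-comm zG dH) (γP[G□H]≤Z[G]*γ[H] ZG γH γP))
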